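{- Let $n,k,t$ be integers with $n>2k-t$ and $k>t>0$, and let $\Gamma=K(n,k,t)$. Then the maximum degree satisfies $$\Delta(\Gamma)\le |V(\Gamma)|-\binom{n-t}{k-t}-(k-t)t\binom{n-k}{k-t}.$$
   Context: For integers $k>t\ge 1$ and $n>2k-t$, the generalized Kneser graph $K(n,k,t)$ has as vertices the $k$-element subsets of $[n]=\{1,\dots,n\}$, two vertices $K,K'$ being adjacent iff $|K\cap K'|<t$. $\Delta(\Gamma)$ denotes the maximum vertex degree of $\Gamma$. Binomial coefficients follow the convention $\binom{a}{b}=0$ whenever $b<0$ or $b>a$. -}

module Defs where

open import Data.Nat using (ℕ; zero; suc; _<?_; _⊔_)
open import Data.Nat.Properties using (_≟_)
open import Data.Bool using (true; false)
open import Data.Vec using ([]; _∷_)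
open import Data.List using (List; []; _∷_; map; _++_; filter; length; foldr)
open import Data.Fin.Subset using (Subset; ∣_∣; _∩_)

allSubsets : (n : ℕ) → List (Subset n)
allSubsets zero    = [] ∷ []
allSubsets (suc n) = map (false ∷_) (allSubsets n) ++ map (true ∷_) (allSubsets n)

KVertices : (n k : ℕ) → List (Subset n)
KVertices n k = filter (λ s → ∣ s ∣ ≟ k) (allSubsets n)

KNeighbours : (n k t : ℕ) → Subset n → List (Subset n)
KNeighbours n k t K = filter (λ K′ → ∣ K ∩ K′ ∣ <? t) (KVertices n k)

Kdegree : (n k t : ℕ) → Subset n → ℕ
Kdegree n k t K = length (KNeighbours n k t K)

Korder : (n k t : ℕ) → ℕ
Korder n k t = length (KVertices n k)

KmaxDegree : (n k t : ℕ) → ℕ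
KmaxDegree n k t = foldr _⊔_ 0 (map (Kdegree n k t) (KVertices n k))

-- Fix a vertex K and T ⊆ K with |T| = t. The non-neighbours of K are the k-sets
-- meeting K in at least t points, and among them are the C(n−t, k−t) sets containing T and,
-- for each x ∈ T and y ∈ K ∖ T, the C(n−k, k−t) sets (T ∖ {x}) ∪ {y} ∪ R with R ⊆ [n] ∖ K.
-- Hence deg K = |V| − #non-neighbours is at most the stated bound. All counts are of
-- subsets s of [n] selected by a predicate of (|K ∩ s|, |s|), so they depend only on |K| and n.
module Submission where

open import Defs
open import Data.Nat
open import Data.Nat.Properties
open import Algebra.Properties.CommutativeSemigroup +-commutativeSemigroup using (interchange; x∙yz≈y∙xz)
open import Data.Nat.Combinatorics using (_C_; nCk+nC[k+1]≡[n+1]C[k+1])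
open import Data.Bool using (Bool; true; false; not; _∧_; if_then_else_)
open import Data.Bool.Properties using (∧-comm)
open import Data.Vec using ([]; _∷_)
open import Data.List using (List; []; _∷_; map; _++_; filter; length)
open import Data.List.Properties using (foldr-preservesᵇ)
open import Data.List.Relation.Unary.All as All using (All)
open import Data.List.Relation.Unary.All.Properties using (all-filter; map⁺)
open import Data.Fin.Subset using (Subset; ∣_∣; _∩_; ⊥)
open import Data.Fin.Subset.Properties using (∣p∣≤n; ∣⊥∣≡0)
open import Data.Product using (Σ; _,_)
open import Function using (_∘_)
open import Relation.Nullary using (does)
open import Relation.Unary using (Decidable)
open import Relation.Binary.PropositionalEquality

countᵇ : {A : Set} → (A → Bool) → List A → ℕ
countᵇ p []       = 0
countᵇ p (x ∷ xs) = if p x then suc (countᵇ p xs) else countᵇ p xs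

module _ {A : Set} where

  length-filter≡countᵇ : {P : A → Set} (P? : Decidable P) (xs : List A) →
                         length (filter P? xs) ≡ countᵇ (does ∘ P?) xs
  length-filter≡countᵇ P? []       = refl
  length-filter≡countᵇ P? (x ∷ xs) with does (P? x)
  ... | true  = cong suc (length-filter≡countᵇ P? xs)
  ... | false = length-filter≡countᵇ P? xs

  countᵇ-filter : (p : A → Bool) {Q : A → Set} (Q? : Decidable Q) (xs : List A) →
                  countᵇ p (filter Q? xs) ≡ countᵇ (λ x → does (Q? x) ∧ p x) xs
  countᵇ-filter p Q? []       = refl
  countᵇ-filter p Q? (x ∷ xs) with does (Q? x)
  ... | true  rewrite countᵇ-filter p Q? xs = refl
  ... | false = countᵇ-filter p Q? xs

  countᵇ-++ : (p : A → Bool) (xs ys : List A) → countᵇ p (xs ++ ys) ≡ countᵇ p xs + countᵇ p ys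
  countᵇ-++ p []       ys = refl
  countᵇ-++ p (x ∷ xs) ys with p x
  ... | true  = cong suc (countᵇ-++ p xs ys)
  ... | false = countᵇ-++ p xs ys

  countᵇ-∧-split : (q p : A → Bool) (xs : List A) →
                   countᵇ q xs ≡ countᵇ (λ x → q x ∧ p x) xs + countᵇ (λ x → q x ∧ not (p x)) xs
  countᵇ-∧-split q p []       = refl
  countᵇ-∧-split q p (x ∷ xs) with q x | p x
  ... | true  | true  = cong suc (countᵇ-∧-split q p xs)
  ... | true  | false = trans (cong suc (countᵇ-∧-split q p xs)) (sym (+-suc _ _))
  ... | false | _     = countᵇ-∧-split q p xs

  countᵇ-cong : {p q : A → Bool} → (∀ x → p x ≡ q x) → (xs : List A) → countᵇ p xs ≡ countᵇ q xs
  countᵇ-cong p≗q []       = refl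
  countᵇ-cong p≗q (x ∷ xs) rewrite p≗q x | countᵇ-cong p≗q xs = refl

countᵇ-map : {A B : Set} (p : B → Bool) (f : A → B) (xs : List A) →
             countᵇ p (map f xs) ≡ countᵇ (p ∘ f) xs
countᵇ-map p f []       = refl
countᵇ-map p f (x ∷ xs) rewrite countᵇ-map p f xs = refl

countᵇ-allSubsets-suc : ∀ n (p : Subset (suc n) → Bool) →
  countᵇ p (allSubsets (suc n)) ≡ countᵇ (p ∘ (false ∷_)) (allSubsets n) + countᵇ (p ∘ (true ∷_)) (allSubsets n)
countᵇ-allSubsets-suc n p = begin
  countᵇ p (map (false ∷_) (allSubsets n) ++ map (true ∷_) (allSubsets n))
    ≡⟨ countᵇ-++ p (map (false ∷_) (allSubsets n)) (map (true ∷_) (allSubsets n)) ⟩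
  countᵇ p (map (false ∷_) (allSubsets n)) + countᵇ p (map (true ∷_) (allSubsets n))
    ≡⟨ cong₂ _+_ (countᵇ-map p (false ∷_) (allSubsets n)) (countᵇ-map p (true ∷_) (allSubsets n)) ⟩
  countᵇ (p ∘ (false ∷_)) (allSubsets n) + countᵇ (p ∘ (true ∷_)) (allSubsets n) ∎
  where open ≡-Reasoning

Profile : Set
Profile = ℕ → ℕ → Bool

inside outside : Profile → Profile
inside  F x y = F (suc x) (suc y)
outside F x y = F x (suc y)

-- profileCount a b F counts the subsets s of A ⊎ B, |A| = a, |B| = b, with F |s ∩ A| |s|;
-- inside F and outside F are the profiles left once one point of A (resp. B) is put into s.
profileCount : ℕ → ℕ → Profile → ℕ
profileCount zero    zero    F = if F 0 0 then 1 else 0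
profileCount zero    (suc b) F = profileCount 0 b F + profileCount 0 b (outside F)
profileCount (suc a) b       F = profileCount a b F + profileCount a b (inside F)

profileCount-suc-outside : ∀ a b F →
  profileCount a (suc b) F ≡ profileCount a b F + profileCount a b (outside F)
profileCount-suc-outside zero    b F = refl
profileCount-suc-outside (suc a) b F
  rewrite profileCount-suc-outside a b F | profileCount-suc-outside a b (inside F) =
  interchange (profileCount a b F) (profileCount a b (outside F))
              (profileCount a b (inside F)) (profileCount a b (outside (inside F)))

countᵇ-allSubsets-byProfile : ∀ n (K : Subset n) F →
  countᵇ (λ s → F ∣ K ∩ s ∣ ∣ s ∣) (allSubsets n) ≡ profileCount ∣ K ∣ (n ∸ ∣ K ∣) F
countᵇ-allSubsets-byProfile zero    []        F = refl
countᵇ-allSubsets-byProfile (suc n) (true ∷ K) F =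
  trans (countᵇ-allSubsets-suc n _)
        (cong₂ _+_ (countᵇ-allSubsets-byProfile n K F) (countᵇ-allSubsets-byProfile n K (inside F)))
countᵇ-allSubsets-byProfile (suc n) (false ∷ K) F = begin
  countᵇ (λ s → F ∣ (false ∷ K) ∩ s ∣ ∣ s ∣) (allSubsets (suc n))
    ≡⟨ countᵇ-allSubsets-suc n _ ⟩
  countᵇ (profileOf F) (allSubsets n) + countᵇ (profileOf (outside F)) (allSubsets n)
    ≡⟨ cong₂ _+_ (countᵇ-allSubsets-byProfile n K F) (countᵇ-allSubsets-byProfile n K (outside F)) ⟩
  profileCount a (n ∸ a) F + profileCount a (n ∸ a) (outside F)
    ≡⟨ sym (profileCount-suc-outside a (n ∸ a) F) ⟩
  profileCount a (suc (n ∸ a)) F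
    ≡⟨ cong (λ b → profileCount a b F) (sym (+-∸-assoc 1 (∣p∣≤n K))) ⟩
  profileCount a (suc n ∸ a) F ∎
  where
  open ≡-Reasoning
  a = ∣ K ∣
  profileOf : Profile → Subset n → Bool
  profileOf G s = G ∣ K ∩ s ∣ ∣ s ∣

hasSize : ℕ → Profile
hasSize m _ y = y ≡ᵇ m

profileCount-never : ∀ a b → profileCount a b (λ _ _ → false) ≡ 0
profileCount-never zero    zero    = refl
profileCount-never zero    (suc b) = cong₂ _+_ (profileCount-never 0 b) (profileCount-never 0 b)
profileCount-never (suc a) b       = cong₂ _+_ (profileCount-never a b) (profileCount-never a b)

-- inside (hasSize m) and outside (hasSize m) coincide, so this one Pascal step serves
-- both recursive clauses of profileCount.
pascal-hasSize : ∀ N (count : Profile → ℕ) → count (λ _ _ → false) ≡ 0 → (∀ m → count (hasSize m) ≡ N C m) →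
  ∀ m → count (hasSize m) + count (outside (hasSize m)) ≡ suc N C m
pascal-hasSize N count never ih zero    = cong₂ _+_ (ih 0) never
pascal-hasSize N count never ih (suc m) = trans (+-comm (count (hasSize (suc m))) _)
  (trans (cong₂ _+_ (ih m) (ih (suc m))) (nCk+nC[k+1]≡[n+1]C[k+1] N m))

profileCount-hasSize : ∀ a b m → profileCount a b (hasSize m) ≡ (a + b) C m
profileCount-hasSize zero    zero    zero    = refl
profileCount-hasSize zero    zero    (suc m) = refl
profileCount-hasSize zero    (suc b) m       =
  pascal-hasSize b (profileCount 0 b) (profileCount-never 0 b) (profileCount-hasSize 0 b) m
profileCount-hasSize (suc a) b       m       =
  pascal-hasSize (a + b) (profileCount a b) (profileCount-never a b) (profileCount-hasSize a b) m

profileCount-zero≤ : ∀ a b F → profileCount 0 b F ≤ profileCount a b F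
profileCount-zero≤ zero    b F = ≤-refl
profileCount-zero≤ (suc a) b F = ≤-trans (profileCount-zero≤ a b F) (m≤m+n _ _)

nCk≤[m+n]Ck : ∀ m n k → n C k ≤ (m + n) C k
nCk≤[m+n]Ck m n k = begin
  n C k                       ≡⟨ profileCount-hasSize 0 n k ⟨
  profileCount 0 n (hasSize k) ≤⟨ profileCount-zero≤ m n (hasSize k) ⟩
  profileCount m n (hasSize k) ≡⟨ profileCount-hasSize m n k ⟩
  (m + n) C k                 ∎
  where open ≤-Reasoning

-- Negates the adjacency test of Defs definitionally (up to ∧-comm): does (x <? t) is x <ᵇ t.
nonAdjacent : ℕ → ℕ → Profile
nonAdjacent t k x y = not (x <ᵇ t) ∧ (y ≡ᵇ k)

nonNeighbourCount : ℕ → ℕ → ℕ → ℕ → ℕ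
nonNeighbourCount a b k t = profileCount a b (nonAdjacent t k)

-- The right-hand side is bounded below by the sets through c fixed points of A.
nonNeighbourCount-fixInside : ∀ c a b k t →
  nonNeighbourCount a b k t ≤ nonNeighbourCount (c + a) b (c + k) (c + t)
nonNeighbourCount-fixInside zero    a b k t = ≤-refl
nonNeighbourCount-fixInside (suc c) a b k t =
  ≤-trans (nonNeighbourCount-fixInside c a b k t) (m≤n+m _ _)

nonNeighbourCount-oneInside : ∀ a b m → a * (b C m) ≤ nonNeighbourCount a b (suc m) 1
nonNeighbourCount-oneInside zero    b m = z≤n
nonNeighbourCount-oneInside (suc a) b m = begin
  b C m + a * (b C m)                  ≡⟨ +-comm (b C m) _ ⟩
  a * (b C m) + b C m                  ≤⟨ +-mono-≤ (nonNeighbourCount-oneInside a b m) (nCk≤[m+n]Ck a b m) ⟩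
  N + (a + b) C m                      ≡⟨ cong (N +_) (profileCount-hasSize a b m) ⟨
  N + profileCount a b (hasSize m)     ∎
  where
  open ≤-Reasoning
  N = nonNeighbourCount a b (suc m) 1

-- Here A = T ⊎ A′ with |T| = t. Split by a point x ∈ T: the sets through x (induction)
-- and the sets through T ∖ {x} avoiding x, which need a point of A′.
nonNeighbourCount-lowerBound : ∀ t a b m →
  (a + b) C m + t * nonNeighbourCount a b (suc m) 1 ≤ nonNeighbourCount (t + a) b (t + m) t
nonNeighbourCount-lowerBound zero    a b m = ≤-reflexive (trans (+-identityʳ _) (sym (profileCount-hasSize a b m)))
nonNeighbourCount-lowerBound (suc t) a b m = begin
  (a + b) C m + (N + t * N)   ≡⟨ x∙yz≈y∙xz ((a + b) C m) N (t * N) ⟩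
  N + ((a + b) C m + t * N)   ≤⟨ +-mono-≤ missingOne (nonNeighbourCount-lowerBound t a b m) ⟩
  nonNeighbourCount (t + a) b (suc (t + m)) (suc t) + nonNeighbourCount (t + a) b (t + m) t ∎
  where
  open ≤-Reasoning
  N = nonNeighbourCount a b (suc m) 1
  missingOne : N ≤ nonNeighbourCount (t + a) b (suc (t + m)) (suc t)
  missingOne = subst₂ (λ k s → N ≤ nonNeighbourCount (t + a) b k s)
    (+-suc t m) (+-comm t 1) (nonNeighbourCount-fixInside t a b (suc m) 1)

nonNeighbourLowerBound : ℕ → ℕ → ℕ → ℕ
nonNeighbourLowerBound n k t = (n ∸ t) C (k ∸ t) + (k ∸ t) * t * ((n ∸ k) C (k ∸ t))

nonNeighbourCount-≥-lowerBound : ∀ {n k t} → t ≤ k → k ≤ n →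
  nonNeighbourLowerBound n k t ≤ nonNeighbourCount k (n ∸ k) k t
nonNeighbourCount-≥-lowerBound {n} {k} {t} t≤k k≤n = begin
  (n ∸ t) C a + a * t * (b C a)        ≡⟨ cong ((n ∸ t) C a +_) (trans (cong (_* (b C a)) (*-comm a t)) (*-assoc t a _)) ⟩
  (n ∸ t) C a + t * (a * (b C a))      ≤⟨ +-monoʳ-≤ ((n ∸ t) C a) (*-monoʳ-≤ t (nonNeighbourCount-oneInside a b a)) ⟩
  (n ∸ t) C a + t * nonNeighbourCount a b (suc a) 1
    ≡⟨ cong (λ m → m C a + t * nonNeighbourCount a b (suc a) 1) a+b≡n∸t ⟨
  (a + b) C a + t * nonNeighbourCount a b (suc a) 1 ≤⟨ nonNeighbourCount-lowerBound t a b a ⟩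
  nonNeighbourCount (t + a) b (t + a) t ≡⟨ cong (λ m → nonNeighbourCount m b m t) (m+[n∸m]≡n t≤k) ⟩
  nonNeighbourCount k b k t            ∎
  where
  open ≤-Reasoning
  a = k ∸ t
  b = n ∸ k
  a+b≡n∸t : a + b ≡ n ∸ t
  a+b≡n∸t = trans (+-comm a b) (trans (sym (+-∸-assoc b t≤k)) (cong (_∸ t) (m∸n+n≡m k≤n)))

Korder≡Kdegree+nonNeighbourCount : ∀ n k t (K : Subset n) →
  Korder n k t ≡ Kdegree n k t K + nonNeighbourCount ∣ K ∣ (n ∸ ∣ K ∣) k t
Korder≡Kdegree+nonNeighbourCount n k t K = begin
  length (filter isVertex? L)                      ≡⟨ length-filter≡countᵇ isVertex? L ⟩
  countᵇ isVertex L                                ≡⟨ countᵇ-∧-split isVertex isNeighbour L ⟩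
  countᵇ (λ s → isVertex s ∧ isNeighbour s) L + countᵇ (λ s → isVertex s ∧ not (isNeighbour s)) L
    ≡⟨ cong₂ _+_ (sym degree≡) (countᵇ-cong (λ s → ∧-comm (isVertex s) _) L) ⟩
  Kdegree n k t K + countᵇ (λ s → nonAdjacent t k ∣ K ∩ s ∣ ∣ s ∣) L
    ≡⟨ cong (Kdegree n k t K +_) (countᵇ-allSubsets-byProfile n K (nonAdjacent t k)) ⟩
  Kdegree n k t K + nonNeighbourCount ∣ K ∣ (n ∸ ∣ K ∣) k t ∎
  where
  open ≡-Reasoning
  L = allSubsets n
  isVertex? = λ (s : Subset n) → ∣ s ∣ ≟ k
  isNeighbour? = λ (s : Subset n) → ∣ K ∩ s ∣ <? t
  isVertex isNeighbour : Subset n → Bool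
  isVertex    = does ∘ isVertex?
  isNeighbour = does ∘ isNeighbour?
  degree≡ : Kdegree n k t K ≡ countᵇ (λ s → isVertex s ∧ isNeighbour s) L
  degree≡ = trans (length-filter≡countᵇ isNeighbour? (filter isVertex? L)) (countᵇ-filter isNeighbour isVertex? L)

Kdegree+lowerBound≤Korder : ∀ {n k t} (K : Subset n) → ∣ K ∣ ≡ k → t ≤ k → k ≤ n →
  Kdegree n k t K + nonNeighbourLowerBound n k t ≤ Korder n k t
Kdegree+lowerBound≤Korder {n} {k} {t} K refl t≤k k≤n = begin
  Kdegree n k t K + nonNeighbourLowerBound n k t
    ≤⟨ +-monoʳ-≤ (Kdegree n k t K) (nonNeighbourCount-≥-lowerBound t≤k k≤n) ⟩
  Kdegree n k t K + nonNeighbourCount k (n ∸ k) k t ≡⟨ Korder≡Kdegree+nonNeighbourCount n k t K ⟨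
  Korder n k t ∎
  where open ≤-Reasoning

subsetOfSize : ∀ {n k} → k ≤ n → Σ (Subset n) (λ K → ∣ K ∣ ≡ k)
subsetOfSize {n}     {zero}  _         = ⊥ , ∣⊥∣≡0 n
subsetOfSize {suc n} {suc k} (s≤s k≤n) with subsetOfSize k≤n
... | K , ∣K∣≡k = true ∷ K , cong suc ∣K∣≡k

KmaxDegree-lub : ∀ {n k t B} → (∀ K → ∣ K ∣ ≡ k → Kdegree n k t K ≤ B) → KmaxDegree n k t ≤ B
KmaxDegree-lub {n} {k} {t} {B} degree≤B =
  foldr-preservesᵇ {P = _≤ B} ⊔-lub z≤n (map⁺ (All.map (λ {K} → degree≤B K) vertexSizes))
  where
  vertexSizes : All (λ K → ∣ K ∣ ≡ k) (KVertices n k)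
  vertexSizes = all-filter (λ s → ∣ s ∣ ≟ k) (allSubsets n)

k≤2k∸t : ∀ {k t} → t ≤ k → k ≤ 2 * k ∸ t
k≤2k∸t {k} {t} t≤k = begin
  k          ≡⟨ m+n∸n≡m k k ⟨
  k + k ∸ k  ≤⟨ ∸-monoʳ-≤ (k + k) t≤k ⟩
  k + k ∸ t  ≡⟨ cong (λ z → k + z ∸ t) (+-identityʳ k) ⟨
  2 * k ∸ t  ∎
  where open ≤-Reasoning

corollary2p2 : (n k t : ℕ) → 0 < t → t < k → 2 * k ∸ t < n →
    KmaxDegree n k t + (n ∸ t) C (k ∸ t) + (k ∸ t) * t * ((n ∸ k) C (k ∸ t))
      ≤ Korder n k t
corollary2p2 n k t _ t<k 2k∸t<n = begin
  KmaxDegree n k t + (n ∸ t) C (k ∸ t) + (k ∸ t) * t * ((n ∸ k) C (k ∸ t))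
                                ≡⟨ +-assoc (KmaxDegree n k t) _ _ ⟩
  KmaxDegree n k t + S          ≤⟨ +-monoˡ-≤ S (KmaxDegree-lub (λ K ∣K∣≡k → m+n≤o⇒m≤o∸n _ (bound K ∣K∣≡k))) ⟩
  Korder n k t ∸ S + S          ≡⟨ m∸n+n≡m S≤Korder ⟩
  Korder n k t                  ∎
  where
  open ≤-Reasoning
  S = nonNeighbourLowerBound n k t
  t≤k = <⇒≤ t<k
  k≤n = ≤-trans (k≤2k∸t t≤k) (<⇒≤ 2k∸t<n)
  bound : ∀ K → ∣ K ∣ ≡ k → Kdegree n k t K + S ≤ Korder n k t
  bound K ∣K∣≡k = Kdegree+lowerBound≤Korder K ∣K∣≡k t≤k k≤n
  S≤Korder : S ≤ Korder n k t
  S≤Korder with subsetOfSize k≤n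
  ... | K , ∣K∣≡k = m+n≤o⇒n≤o (Kdegree n k t K) (bound K ∣K∣≡k)
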